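{- Let $p,r\in\mathbb{N}$ with $p\geq 2$ and let $n=T(p,r)$. Then for any $r$-coloring of $\binom{[n]}{p-1}$ there exists $P\subseteq[n]$ with $|P|=p$ such that $P_*$ and $P^*$ have the same color.
   Context: $[n]=\{1,\dots,n\}$; $\binom{Y}{m}$ is the set of $m$-element subsets of $Y$; an $r$-coloring is a map into $[r]$. $T:\mathbb{N}\times\mathbb{N}\to\mathbb{N}$ is defined by $T(1,r)=1$, $T(2,r)=r+1$ and $T(n+1,r)=T(n,2^r)$ for $n\geq 2$. For a nonempty finite $P\subseteq\mathbb{N}$, $P_*=P\setminus\{\min P\}$ and $P^*=P\setminus\{\max P\}$. -}

module Defs where

open import Data.Nat using (ℕ; zero; suc; _^_)
open import Data.Bool using (Bool; true; false; if_then_else_; _∨_)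
open import Data.Vec using (Vec; []; _∷_)
open import Data.Fin.Subset using (Subset)

-- The tower function T of the paper:
-- T(1,r) = 1, T(2,r) = r+1, T(n+1,r) = T(n,2^r) for n ≥ 2.
-- (T 0 r is not used by the paper; it is set to 1 arbitrarily.)
T : ℕ → ℕ → ℕ
T zero r = 1
T (suc zero) r = 1
T (suc (suc zero)) r = suc r
T (suc (suc (suc n))) r = T (suc (suc n)) (2 ^ r)

nonempty : ∀ {n} → Subset n → Bool
nonempty [] = false
nonempty (x ∷ xs) = x ∨ nonempty xs

dropMin : ∀ {n} → Subset n → Subset n
dropMin [] = []
dropMin (true ∷ xs) = false ∷ xs
dropMin (false ∷ xs) = false ∷ dropMin xs

dropMax : ∀ {n} → Subset n → Subset n
dropMax [] = []
dropMax (x ∷ xs) = if nonempty xs then x ∷ dropMax xs else false ∷ xs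

-- Stepping up from p-1 to p. Given an r-colouring c of the (p-1)-sets, colour each (p-2)-set q
-- by the set of colours c(q ∪ {x}) over all x > max q, a 2^r-colouring. Take a (p-1)-set P on
-- which this colouring agrees at P_* and P^*. Since max P extends P^* with colour c P, some
-- x > max P extends P_* with colour c P, and P ∪ {x} works: its shadows are P_* ∪ {x} and P.
-- For p = 2 it is the pigeonhole principle on the r+1 singletons.
module Submission where

open import Defs
open import Data.Bool using (true; false; _∨_)
open import Data.Bool.Properties using (∨-zeroʳ) renaming (_≟_ to _≟ᵇ_)
open import Data.Fin using (Fin; zero; suc; _<_; funToFin; finToFun)
open import Data.Fin.Properties using (any?; pigeonhole; finToFun-funToFin; 2↔Bool)
  renaming (_≟_ to _≟ᶠ_)
open import Data.Fin.Subset using (Subset; ∣_∣; ⊥)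
open import Data.Fin.Subset.Properties using (∣⊥∣≡0)
open import Data.Nat using (ℕ; zero; suc; _+_; _^_; _∸_; _≤_; z≤n; s≤s) renaming (_<_ to _<ℕ_)
open import Data.Nat.Properties
  using (suc-injective; ≤-refl; ≤-reflexive; ≤-trans; m≤m+n; n<1+n; +-suc; +-monoʳ-≤; +-mono-≤-<; m^n>0; ≡-irrelevant)
  renaming (_≟_ to _≟ⁿ_)
open import Data.Product using (Σ; ∃; _×_; _,_)
open import Data.Vec using ([]; _∷_; _[_]≔_)
open import Function.Bundles using (module Inverse)
open import Relation.Binary.PropositionalEquality
  using (_≡_; refl; sym; trans; cong; module ≡-Reasoning)
open import Relation.Nullary using (Dec; yes; no; does; contradiction)
open import Relation.Nullary.Decidable using (_×-dec_; dec-true)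

private variable
  n m : ℕ

private module Bit = Inverse 2↔Bool

infix 4 _≺_ _≺?_

-- p ≺ x: every element of p is smaller than x.
_≺_ : Subset n → Fin n → Set
(b ∷ p) ≺ zero  = b ∨ nonempty p ≡ false
(b ∷ p) ≺ suc x = p ≺ x

_≺?_ : (p : Subset n) (x : Fin n) → Dec (p ≺ x)
(b ∷ p) ≺? zero  = b ∨ nonempty p ≟ᵇ false
(b ∷ p) ≺? suc x = p ≺? x

nonempty-⊥ : ∀ n → nonempty (⊥ {n}) ≡ false
nonempty-⊥ zero    = refl
nonempty-⊥ (suc n) = nonempty-⊥ n

⊥≺ : (x : Fin n) → ⊥ ≺ x
⊥≺ {suc n} zero = nonempty-⊥ n
⊥≺ (suc x)      = ⊥≺ x

⊥[]≔true≺ : {i j : Fin n} → i < j → ⊥ [ i ]≔ true ≺ j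
⊥[]≔true≺ {i = zero}  {suc j} _         = ⊥≺ j
⊥[]≔true≺ {i = suc i} {suc j} (s≤s i<j) = ⊥[]≔true≺ i<j

∣p∣≡suc⇒nonempty : (p : Subset n) → ∣ p ∣ ≡ suc m → nonempty p ≡ true
∣p∣≡suc⇒nonempty (true  ∷ p) _ = refl
∣p∣≡suc⇒nonempty (false ∷ p) e = ∣p∣≡suc⇒nonempty p e

nonempty-[]≔true : (p : Subset n) (x : Fin n) → nonempty (p [ x ]≔ true) ≡ true
nonempty-[]≔true (b ∷ p) zero = refl
nonempty-[]≔true (b ∷ p) (suc x) rewrite nonempty-[]≔true p x = ∨-zeroʳ b

∣[]≔true∣ : (p : Subset n) (x : Fin n) → p ≺ x → ∣ p [ x ]≔ true ∣ ≡ suc ∣ p ∣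
∣[]≔true∣ (false ∷ p) zero    _ = refl
∣[]≔true∣ (true  ∷ p) zero    ()
∣[]≔true∣ (false ∷ p) (suc x) h = ∣[]≔true∣ p x h
∣[]≔true∣ (true  ∷ p) (suc x) h = cong suc (∣[]≔true∣ p x h)

∣dropMin∣ : (p : Subset n) → ∣ p ∣ ≡ suc m → ∣ dropMin p ∣ ≡ m
∣dropMin∣ (true  ∷ p) e = suc-injective e
∣dropMin∣ (false ∷ p) e = ∣dropMin∣ p e

suc∣dropMax∣ : (p : Subset n) → nonempty p ≡ true → suc ∣ dropMax p ∣ ≡ ∣ p ∣
suc∣dropMax∣ (b ∷ p) ne with nonempty p in eq
suc∣dropMax∣ (true  ∷ p) ne | true  = cong suc (suc∣dropMax∣ p eq)
suc∣dropMax∣ (false ∷ p) ne | true  = suc∣dropMax∣ p eq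
suc∣dropMax∣ (true  ∷ p) ne | false = refl

∣dropMax∣ : (p : Subset n) → ∣ p ∣ ≡ suc m → ∣ dropMax p ∣ ≡ m
∣dropMax∣ p e = suc-injective (trans (suc∣dropMax∣ p (∣p∣≡suc⇒nonempty p e)) e)

dropMin-[]≔true : (p : Subset n) (x : Fin n) → p ≺ x → nonempty p ≡ true →
                  dropMin (p [ x ]≔ true) ≡ dropMin p [ x ]≔ true
dropMin-[]≔true (b     ∷ p) zero    h ne = contradiction (trans (sym ne) h) λ ()
dropMin-[]≔true (true  ∷ p) (suc x) h ne = refl
dropMin-[]≔true (false ∷ p) (suc x) h ne = cong (false ∷_) (dropMin-[]≔true p x h ne)

dropMax-[]≔true : (p : Subset n) (x : Fin n) → p ≺ x → dropMax (p [ x ]≔ true) ≡ p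
dropMax-[]≔true (true  ∷ p) zero    ()
dropMax-[]≔true (false ∷ p) zero    h rewrite h = refl
dropMax-[]≔true (b     ∷ p) (suc x) h rewrite nonempty-[]≔true p x =
  cong (b ∷_) (dropMax-[]≔true p x h)

dropMin-≺ : (p : Subset n) (x : Fin n) → nonempty (dropMin p) ≡ true → dropMin p ≺ x → p ≺ x
dropMin-≺ (true  ∷ p) zero    ne h = contradiction (trans (sym ne) h) λ ()
dropMin-≺ (true  ∷ p) (suc x) ne h = h
dropMin-≺ (false ∷ p) zero    ne h = contradiction (trans (sym ne) h) λ ()
dropMin-≺ (false ∷ p) (suc x) ne h = dropMin-≺ p x ne h

dropMin-⊥[]≔true : (i : Fin n) → dropMin (⊥ [ i ]≔ true) ≡ ⊥
dropMin-⊥[]≔true zero    = refl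
dropMin-⊥[]≔true (suc i) = cong (false ∷_) (dropMin-⊥[]≔true i)

split-max : (p : Subset n) → nonempty p ≡ true →
            ∃ λ x → dropMax p ≺ x × dropMax p [ x ]≔ true ≡ p
split-max (b ∷ p) ne with nonempty p in eq
split-max (b     ∷ p) ne | true with x , h , e ← split-max p eq = suc x , h , cong (b ∷_) e
split-max (true  ∷ p) ne | false = zero , eq , refl
split-max (false ∷ p) () | false

DropsAgree : ∀ {r} → (Subset n → Fin r) → ℕ → Set
DropsAgree {n} c m = Σ (Subset n) λ P → ∣ P ∣ ≡ m × c (dropMin P) ≡ c (dropMax P)

dropsAgree-pair : ∀ r (c : Subset (suc r) → Fin r) → DropsAgree c 2
dropsAgree-pair r c with i , j , i<j , cᵢ≡cⱼ ← pigeonhole (n<1+n r) (λ x → c (⊥ [ x ]≔ true)) =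
  P , size , (begin
    c (dropMin P)            ≡⟨ cong c (dropMin-[]≔true Pᵢ j Pᵢ≺j (nonempty-[]≔true ⊥ i)) ⟩
    c (dropMin Pᵢ [ j ]≔ true) ≡⟨ cong (λ q → c (q [ j ]≔ true)) (dropMin-⊥[]≔true i) ⟩
    c (⊥ [ j ]≔ true)        ≡⟨ cᵢ≡cⱼ ⟨
    c Pᵢ                     ≡⟨ cong c (dropMax-[]≔true Pᵢ j Pᵢ≺j) ⟨
    c (dropMax P)            ∎)
  where
  open ≡-Reasoning
  Pᵢ = ⊥ [ i ]≔ true
  P  = Pᵢ [ j ]≔ true
  Pᵢ≺j : Pᵢ ≺ j
  Pᵢ≺j = ⊥[]≔true≺ i<j
  size : ∣ P ∣ ≡ 2
  size = trans (∣[]≔true∣ Pᵢ j Pᵢ≺j)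
               (cong suc (trans (∣[]≔true∣ ⊥ i (⊥≺ i)) (cong suc (∣⊥∣≡0 (suc r)))))

module _ {n r} (c : Subset n → Fin r) where

  ExtendsTo : Subset n → Fin r → Set
  ExtendsTo q i = ∃ λ x → q ≺ x × c (q [ x ]≔ true) ≡ i

  extendsTo? : ∀ q i → Dec (ExtendsTo q i)
  extendsTo? q i = any? λ x → q ≺? x ×-dec c (q [ x ]≔ true) ≟ᶠ i

  -- The set of colours of the extensions of q on top, coded in Fin (2 ^ r) by its
  -- characteristic function Fin r → Fin 2.
  topColours : Subset n → Fin (2 ^ r)
  topColours q = funToFin λ i → Bit.from (does (extendsTo? q i))

  does≡topColours : ∀ q i → does (extendsTo? q i) ≡ Bit.to (finToFun (topColours q) i)
  does≡topColours q i = begin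
    does (extendsTo? q i)                        ≡⟨ Bit.strictlyInverseˡ _ ⟨
    Bit.to (Bit.from (does (extendsTo? q i)))    ≡⟨ cong Bit.to (finToFun-funToFin _ i) ⟨
    Bit.to (finToFun (topColours q) i)           ∎
    where open ≡-Reasoning

  does-cong : ∀ {q q′} i → topColours q ≡ topColours q′ →
              does (extendsTo? q i) ≡ does (extendsTo? q′ i)
  does-cong {q} {q′} i eq = begin
    does (extendsTo? q i)               ≡⟨ does≡topColours q i ⟩
    Bit.to (finToFun (topColours q) i)  ≡⟨ cong (λ t → Bit.to (finToFun t i)) eq ⟩
    Bit.to (finToFun (topColours q′) i) ≡⟨ does≡topColours q′ i ⟨
    does (extendsTo? q′ i)              ∎
    where open ≡-Reasoning

  extendsTo-transfer : ∀ {q q′ i} → topColours q ≡ topColours q′ → ExtendsTo q′ i → ExtendsTo q i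
  extendsTo-transfer {q} {q′} {i} eq w with extendsTo? q i | does-cong i eq
  ... | yes w′ | _ = w′
  ... | no _   | e = contradiction (trans e (dec-true (extendsTo? q′ i) w)) λ ()

  dropMax-extendsTo : ∀ P → nonempty P ≡ true → ExtendsTo (dropMax P) (c P)
  dropMax-extendsTo P ne with x , h , e ← split-max P ne = x , h , cong c e

  stepUp : DropsAgree topColours (suc (suc m)) → DropsAgree c (suc (suc (suc m)))
  stepUp (P , ∣P∣ , agree)
    with neP ← ∣p∣≡suc⇒nonempty P ∣P∣
    with x , P₋≺x , colour ← extendsTo-transfer agree (dropMax-extendsTo P neP) =
    P [ x ]≔ true , trans (∣[]≔true∣ P x P≺x) (cong suc ∣P∣) , (begin
      c (dropMin (P [ x ]≔ true)) ≡⟨ cong c (dropMin-[]≔true P x P≺x neP) ⟩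
      c (dropMin P [ x ]≔ true)   ≡⟨ colour ⟩
      c P                         ≡⟨ cong c (dropMax-[]≔true P x P≺x) ⟨
      c (dropMax (P [ x ]≔ true)) ∎)
    where
    open ≡-Reasoning
    P≺x : P ≺ x
    P≺x = dropMin-≺ P x (∣p∣≡suc⇒nonempty (dropMin P) (∣dropMin∣ P ∣P∣)) P₋≺x

dropsAgree : ∀ k r (c : Subset (T (2 + k) r) → Fin r) → DropsAgree c (2 + k)
dropsAgree zero    r c = dropsAgree-pair r c
dropsAgree (suc k) r c = stepUp c (dropsAgree k (2 ^ r) (topColours c))

n<2^n : ∀ n → n <ℕ 2 ^ n
n<2^n zero    = s≤s z≤n
n<2^n (suc n) = +-mono-≤-< (m^n>0 2 n) (≤-trans (n<2^n n) (m≤m+n (2 ^ n) 0))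

k+r<T : ∀ k r → k + r <ℕ T (2 + k) r
k+r<T zero    r = ≤-refl
k+r<T (suc k) r = ≤-trans (s≤s (≤-trans (≤-reflexive (sym (+-suc k r))) (+-monoʳ-≤ k (n<2^n r))))
                          (k+r<T k (2 ^ r))

subsetOfSize : m ≤ n → Σ (Subset n) λ S → ∣ S ∣ ≡ m
subsetOfSize {zero} {n} _ = ⊥ , ∣⊥∣≡0 n
subsetOfSize {suc m} (s≤s m≤n) with S , e ← subsetOfSize m≤n = true ∷ S , cong suc e

module _ {A : Set} (c : (S : Subset n) → ∣ S ∣ ≡ m → A) (default : A) where

  extend : Subset n → A
  extend S with ∣ S ∣ ≟ⁿ m
  ... | yes e = c S e
  ... | no _  = default

  extend-agrees : ∀ S e → extend S ≡ c S e
  extend-agrees S e with ∣ S ∣ ≟ⁿ m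
  ... | yes e′ = cong (c S) (≡-irrelevant e′ e)
  ... | no ¬e  = contradiction e ¬e

lemma5p1 : (p r : ℕ) → 2 ≤ p →
    (c : (S : Subset (T p r)) → ∣ S ∣ ≡ p ∸ 1 → Fin r) →
    Σ (Subset (T p r)) λ P → ∣ P ∣ ≡ p ×
    Σ (∣ dropMin P ∣ ≡ p ∸ 1) λ e₁ → Σ (∣ dropMax P ∣ ≡ p ∸ 1) λ e₂ →
    c (dropMin P) e₁ ≡ c (dropMax P) e₂
lemma5p1 (suc (suc k)) r (s≤s (s≤s z≤n)) c
  -- some (p-1)-set supplies the default colour of sets of the wrong size
  with S₀ , ∣S₀∣ ← subsetOfSize (≤-trans (m≤m+n (suc k) r) (k+r<T k r))
  with P , ∣P∣ , agree ← dropsAgree k r (extend c (c S₀ ∣S₀∣)) =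
  P , ∣P∣ , e₁ , e₂ , trans (sym (extend-agrees c _ _ e₁)) (trans agree (extend-agrees c _ _ e₂))
  where
  e₁ = ∣dropMin∣ P ∣P∣
  e₂ = ∣dropMax∣ P ∣P∣
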